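{- Let $n\ge1$, $m\ge2$, $M_0,\dots,M_{2^m-1}\in\mathbb{R}^{n\times n}$, and let $k$, $S_i$, $B$ and $e_j$ be as in the context. For any $i\in\{1,\dots,n\}$, writing $A_t=A_t(B,e_1+e_{k+i})$: (1) $A_2=\{e_2\}$; (2) $A_3=\{e_3,e_4\}$; (3) for all $t\in\{4,\dots,3m\}$: if $t$ is not divisible by $3$ then $A_t=\{0\}$, and if $t=3r$ for an integer $r$ then $A_t=\{0,e_{S_{r-1}},e_{S_{r-1}+1},\dots,e_{S_r-1}\}$.
   Context: Let $S_i=2^{i+1}+1$ for $i\ge0$ (so $S_0=3$, $S_i=S_{i-1}+2^i$) and $k=S_m-1=2^{m+1}$. For $x\in\mathbb{R}^{k+n}$, $x_j$ denotes its $j$th coordinate and $\pi(x)\in\mathbb{R}^n$ is given by $\pi(x)_j=x_{k+j}$. Let $e_1,\dots,e_{k+n}$ be the canonical basis of $\mathbb{R}^{k+n}$. Define the bilinear map $B:\mathbb{R}^{k+n}\times\mathbb{R}^{k+n}\to\mathbb{R}^{k+n}$ by: $B(x,y)_1=0$, $B(x,y)_2=x_1y_1$, $B(x,y)_3=x_1y_2$, $B(x,y)_4=x_2y_1$; for all $i\in\{1,\dots,m-1\}$ and $j\in\{0,\dots,2^i-1\}$, $B(x,y)_{2j+S_i}=x_{j+S_{i-1}}y_3$ and $B(x,y)_{2j+1+S_i}=x_{j+S_{i-1}}y_4$; and $\pi(B(x,y))=\sum_{i=0}^{2^m-1}y_{i+S_{m-1}}M_i\pi(x)$. For $v\in\mathbb{R}^{k+n}$,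 $A_1(B,v)=\{v\}$ and for $t\ge2$, $A_t(B,v)=\bigcup_{1\le m'\le t-1}\{B(x,y): x\in A_{m'}(B,v),\ y\in A_{t-m'}(B,v)\}$. -}

module Defs where

open import Level using (Level)
open import Algebra.Bundles using (CommutativeRing)
open import Data.Nat as ℕ using (ℕ; zero; suc; _∸_; _^_; _≡ᵇ_; _<?_)
open import Data.Fin as F using (Fin; toℕ; fromℕ<; splitAt; _↑ʳ_)
open import Data.Sum using (_⊎_; inj₁; inj₂)
open import Data.Bool using (if_then_else_)
open import Relation.Nullary using (yes; no)

S : ℕ → ℕ
S i = 2 ^ (suc i) ℕ.+ 1

-- k = S_m - 1 = 2^(m+1)
kOf : ℕ → ℕ
kOf m = 2 ^ (suc m)

module WithRing {c ℓ : Level} (R : CommutativeRing c ℓ) where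
  open CommutativeRing R

  -- vectors in R^D, coordinates indexed by Fin D (0-based; paper's index = toℕ + 1)
  Vect : ℕ → Set c
  Vect D = Fin D → Carrier

  _≋_ : ∀ {D} → Vect D → Vect D → Set ℓ
  u ≋ w = ∀ j → u j ≈ w j

  sumFin : ∀ {n} → (Fin n → Carrier) → Carrier
  sumFin {zero}  f = 0#
  sumFin {suc n} f = f F.zero + sumFin (λ j → f (F.suc j))

  sumTo : ℕ → (ℕ → Carrier) → Carrier
  sumTo zero    f = 0#
  sumTo (suc n) f = sumTo n f + f n

  ind : ℕ → ℕ → Carrier
  ind a b = if a ≡ᵇ b then 1# else 0#

  -- 1-based coordinate x_j (0 outside 1..D)
  get : ∀ {D} → Vect D → ℕ → Carrier
  get x zero = 0#
  get {D} x (suc j) with j <? D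
  ... | yes p = x (fromℕ< p)
  ... | no _  = 0#

  e : ∀ {D} → ℕ → Vect D
  e j c = ind (suc (toℕ c)) j

  zeroV : ∀ {D} → Vect D
  zeroV c = 0#

  _+V_ : ∀ {D} → Vect D → Vect D → Vect D
  (u +V w) c = u c + w c

  module _ (m n : ℕ) (M : Fin (2 ^ m) → Fin n → Fin n → Carrier) where
    k : ℕ
    k = kOf m

    -- the first k coordinates, c1 = 1-based index in 1..k
    Bk : Vect (k ℕ.+ n) → Vect (k ℕ.+ n) → ℕ → Carrier
    Bk x y 1 = 0#
    Bk x y 2 = get x 1 * get y 1
    Bk x y 3 = get x 1 * get y 2
    Bk x y 4 = get x 2 * get y 1
    Bk x y c1 =
      -- sum over i ∈ {1,…,m-1} (i = suc i') and j ∈ {0,…,2^i - 1}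
      sumTo (m ∸ 1) λ i' → sumTo (2 ^ suc i') λ j →
          ind c1 (2 ℕ.* j ℕ.+ S (suc i')) * (get x (j ℕ.+ S i') * get y 3)
        + ind c1 (2 ℕ.* j ℕ.+ 1 ℕ.+ S (suc i')) * (get x (j ℕ.+ S i') * get y 4)

    B : Vect (k ℕ.+ n) → Vect (k ℕ.+ n) → Vect (k ℕ.+ n)
    B x y c with splitAt k c
    ... | inj₁ c' = Bk x y (suc (toℕ c'))
    ... | inj₂ j  = sumFin λ (i : Fin (2 ^ m)) →
                      get y (toℕ i ℕ.+ S (m ∸ 1)) *
                      sumFin (λ l → M i j l * x (k ↑ʳ l))

    -- A_t(B, v), as a predicate closed under setoid equality
    data A (v : Vect (k ℕ.+ n)) : ℕ → Vect (k ℕ.+ n) → Set (c Level.⊔ ℓ) where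
      base : ∀ {z} → z ≋ v → A v 1 z
      step : ∀ {p q z} (x y : Vect (k ℕ.+ n)) →
             A v (suc p) x → A v (suc q) y → z ≋ B x y →
             A v (suc p ℕ.+ suc q) z

module Submission where

-- Write H = 2^m.  When y vanishes on the coordinates H < l ≤ k, the π-part of B(x, y) is zero and
-- the first k coordinates of B(x, y) are x₁y₁e₂ + x₁y₂e₃ + x₂y₁e₄ + Σ_{3≤l≤H} x_l (y₃e_{2l−1} + y₄e_{2l}).
-- On basis vectors this is a multiplication table, and v = e₁ + e_{k+i} acts as e₁.  So A_t is
-- governed by which labels (basis vectors, v, or 0) can occur at length t: products of occurring
-- labels occur again, and conversely every e_j of the block at t = 3(r + 1) is e_a e₃ or e_a e₄ for
-- an e_a of the block at t = 3r.  The bound t ≤ 3m keeps the labels of all factors at most H, so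
-- the normal form of B applies at every step of the induction.

open import Defs
open import Level using (Level; _⊔_)
open import Algebra.Bundles using (CommutativeRing)
open import Data.Nat using (ℕ; zero; suc; _≤_; _<_; _∸_; _^_; _*_; _+_; z≤n; s≤s; _≡ᵇ_; _<?_)
import Data.Nat.Properties as ℕₚ
open import Data.Nat.Divisibility using (_∣_; divides)
open import Data.Nat.Tactic.RingSolver using (solve-∀)
open import Data.Fin as Fin using (Fin; toℕ; splitAt)
open import Data.Fin.Properties using (toℕ-fromℕ<; toℕ-↑ˡ; toℕ-↑ʳ; splitAt⁻¹-↑ˡ; splitAt⁻¹-↑ʳ; toℕ<n)
open import Data.Bool using (true; false; T)
open import Data.Product using (_×_; _,_; ∃-syntax)
open import Data.Sum using (_⊎_; inj₁; inj₂; [_,_]′)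
open import Data.Empty using (⊥-elim)
open import Function using (_∘_)
open import Function.Bundles using (_⇔_; mk⇔)
open import Relation.Nullary using (¬_; yes; no; contradiction)
open import Relation.Binary.PropositionalEquality as ≡ using (_≡_; _≢_)

-- Labels of the vectors occurring in A_t: 0 stands for the zero vector, 1 for the generator
-- v = e₁ + e_{k+i} and j ≥ 2 for the basis vector e_j.  a ⋆ b is the label of B(x, y) for
-- x, y labelled a, b: e₁e₁ = e₂, e₁e₂ = e₃, e₂e₁ = e₄, e_l e₃ = e_{2l−1}, e_l e₄ = e_{2l}.
module Labels where
  open import Data.Nat.Properties
  open ≡ using (refl; sym; trans; subst; subst₂)

  3≤S : ∀ r → 3 ≤ S r
  3≤S r = +-monoˡ-≤ 1 (*-monoʳ-≤ 2 (m^n>0 2 r))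

  5≤S[1+r] : ∀ r → 5 ≤ S (suc r)
  5≤S[1+r] r = +-monoˡ-≤ 1 (*-monoʳ-≤ 2 (*-monoʳ-≤ 2 (m^n>0 2 r)))

  3≤3*[1+r] : ∀ r → 3 ≤ 3 * suc r
  3≤3*[1+r] r = m≤m*n 3 (suc r)

  3*[1+r]+3≡3*[2+r] : ∀ r → 3 * suc r + 3 ≡ 3 * suc (suc r)
  3*[1+r]+3≡3*[2+r] r = trans (+-comm (3 * suc r) 3) (sym (*-suc 3 (suc r)))

  2*[2+a]≡4+2*a : ∀ a → 2 * (2 + a) ≡ 4 + 2 * a
  2*[2+a]≡4+2*a = solve-∀

  2*[3+a]≡6+2*a : ∀ a → 2 * (3 + a) ≡ 6 + 2 * a
  2*[3+a]≡6+2*a = solve-∀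

  infixl 7 _⋆_
  _⋆_ : ℕ → ℕ → ℕ
  1 ⋆ 1 = 2
  1 ⋆ 2 = 3
  2 ⋆ 1 = 4
  suc (suc (suc a)) ⋆ 3 = 5 + 2 * a
  suc (suc (suc a)) ⋆ 4 = 6 + 2 * a
  _ ⋆ _ = 0

  ⋆-zeroʳ : ∀ a → a ⋆ 0 ≡ 0
  ⋆-zeroʳ zero = refl
  ⋆-zeroʳ (suc zero) = refl
  ⋆-zeroʳ (suc (suc zero)) = refl
  ⋆-zeroʳ (suc (suc (suc a))) = refl

  -- Label t a: the label a occurs in A_t (for t ≤ 3m).  In the block S_r ≤ j ≤ S_{r+1} − 1 at
  -- t = 3(r + 1) the index is written 3 + j so that ⋆ computes on it.
  data Label : ℕ → ℕ → Set where
    generator : Label 1 1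
    square    : Label 2 2
    vanish    : ∀ {t} → 4 ≤ t → Label t 0
    block     : ∀ {r j} → S r ≤ 3 + j → 3 + j ≤ 2 ^ suc (suc r) → Label (3 * suc r) (3 + j)

  label₃ : Label 3 3
  label₃ = block {0} ≤-refl (s≤s (s≤s (s≤s z≤n)))

  label₄ : Label 3 4
  label₄ = block {0} (s≤s (s≤s (s≤s z≤n))) ≤-refl

  block′ : ∀ {r j} → S r ≤ j → j ≤ 2 ^ suc (suc r) → Label (3 * suc r) j
  block′ {r} lo hi with ≤-trans (3≤S r) lo
  block′ {r} {suc (suc (suc j))} lo hi | s≤s (s≤s (s≤s _)) = block lo hi

  block-double : ∀ {r j} → S r ≤ 3 + j → 3 + j ≤ 2 ^ suc (suc r) →
                 S (suc r) ≤ 5 + 2 * j × 6 + 2 * j ≤ 2 ^ suc (suc (suc r))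
  block-double {r} {j} lo hi =
    ≤-pred (subst₂ _≤_ (twice-suc (2 ^ suc r)) (2*[3+a]≡6+2*a j) (*-monoʳ-≤ 2 lo)) ,
    subst (_≤ 2 ^ suc (suc (suc r))) (2*[3+a]≡6+2*a j) (*-monoʳ-≤ 2 hi)
    where
    twice-suc : ∀ X → 2 * (X + 1) ≡ suc (2 * X + 1)
    twice-suc = solve-∀

  Label-⋆ : ∀ {p q a b} → Label p a → Label q b → Label (p + q) (a ⋆ b)
  Label-⋆ (vanish 4≤p) _ = vanish (≤-trans 4≤p (m≤m+n _ _))
  Label-⋆ {p} {q} {a} _ (vanish 4≤q) =
    subst (Label (p + q)) (sym (⋆-zeroʳ a)) (vanish (≤-trans 4≤q (m≤n+m q p)))
  Label-⋆ generator generator = square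
  Label-⋆ generator square = label₃
  Label-⋆ square generator = label₄
  Label-⋆ square square = vanish ≤-refl
  Label-⋆ generator (block {r} _ _) = vanish (s≤s (3≤3*[1+r] r))
  Label-⋆ square (block {r} _ _) = vanish (s≤s (≤-trans (n≤1+n 3) (s≤s (3≤3*[1+r] r))))
  Label-⋆ (block {r} _ _) generator = vanish (+-monoˡ-≤ 1 (3≤3*[1+r] r))
  Label-⋆ (block {r} _ _) square = vanish (≤-trans (n≤1+n 4) (+-monoˡ-≤ 2 (3≤3*[1+r] r)))
  Label-⋆ (block {r} {j} lo hi) (block {zero} {zero} _ _) with block-double {r} lo hi
  ... | lo′ , hi′ = subst (λ t → Label t (5 + 2 * j)) (sym (3*[1+r]+3≡3*[2+r] r))
                     (block {suc r} lo′ (≤-trans (n≤1+n _) hi′))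
  Label-⋆ (block {r} {j} lo hi) (block {zero} {1} _ _) with block-double {r} lo hi
  ... | lo′ , hi′ = subst (λ t → Label t (6 + 2 * j)) (sym (3*[1+r]+3≡3*[2+r] r))
                     (block {suc r} (≤-trans lo′ (n≤1+n _)) hi′)
  Label-⋆ (block {r} _ _) (block {r′} {suc (suc _)} _ _) =
    vanish (≤-trans (m≤m+n 4 2) (+-mono-≤ (3≤3*[1+r] r) (3≤3*[1+r] r′)))
  Label-⋆ (block _ _) (block {suc r′} {zero} lo′ _) =
    ⊥-elim (<⇒≱ (s≤s (s≤s (s≤s (s≤s z≤n)))) (≤-trans (5≤S[1+r] r′) lo′))
  Label-⋆ (block _ _) (block {suc r′} {1} lo′ _) =
    ⊥-elim (<⇒≱ (s≤s (s≤s (s≤s (s≤s (s≤s z≤n))))) (≤-trans (5≤S[1+r] r′) lo′))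

  parity : ∀ n → ∃[ a ] (n ≡ 2 * a ⊎ n ≡ 1 + 2 * a)
  parity zero = 0 , inj₁ refl
  parity (suc n) with parity n
  ... | a , inj₁ refl = a , inj₂ refl
  ... | a , inj₂ refl = suc a , inj₁ (sym (*-suc 2 a))

  halve-lower : ∀ X a → 2 * X + 1 ≤ 6 + 2 * a → X + 1 ≤ 3 + a
  halve-lower X a h = subst (_≤ 3 + a) (+-comm 1 X)
    (*-cancelˡ-< 2 X (3 + a) (subst₂ _≤_ (+-comm (2 * X) 1) (sym (2*[3+a]≡6+2*a a)) h))

  halve-upper : ∀ Y a → 5 + 2 * a ≤ 2 * Y → 3 + a ≤ Y
  halve-upper Y a h = *-cancelˡ-< 2 (2 + a) Y (subst (λ u → suc u ≤ 2 * Y) (sym (2*[2+a]≡4+2*a a)) h)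

  block-halve : ∀ {r j} → S (suc r) ≤ 3 + j → 3 + j ≤ 2 ^ suc (suc (suc r)) →
                ∃[ a ] (S r ≤ 3 + a × 3 + a ≤ 2 ^ suc (suc r) ×
                        (3 + j ≡ (3 + a) ⋆ 3 ⊎ 3 + j ≡ (3 + a) ⋆ 4))
  block-halve {r} {j} lo hi with ≤-trans (5≤S[1+r] r) lo
  block-halve {r} {suc (suc j)} lo hi | s≤s (s≤s (s≤s (s≤s (s≤s _)))) with parity j
  ... | a , inj₁ refl = a , halve-lower _ a (≤-trans lo (n≤1+n _)) , halve-upper _ a hi , inj₁ refl
  ... | a , inj₂ refl = a , halve-lower _ a lo , halve-upper _ a (≤-trans (n≤1+n _) hi) , inj₂ refl

  Label-bound : ∀ {m t a} → Label t a → t < 3 * m → a ≤ 2 ^ m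
  Label-bound {m} generator _ = m^n>0 2 m
  Label-bound {suc m} square _ = *-monoʳ-≤ 2 (m^n>0 2 m)
  Label-bound (vanish _) _ = z≤n
  Label-bound {m} (block {r} _ hi) t<3m = ≤-trans hi (^-monoʳ-≤ 2 (*-cancelˡ-< 3 (suc r) m t<3m))

  Label-2 : ∀ {t a} → Label t a → t ≡ 2 → a ≡ 2
  Label-2 square _ = refl
  Label-2 (vanish (s≤s (s≤s ()))) refl
  Label-2 (block {r} _ _) eq = ⊥-elim (<⇒≱ (s≤s (s≤s (s≤s z≤n))) (subst (3 ≤_) eq (3≤3*[1+r] r)))

  Label-3 : ∀ {t a} → Label t a → t ≡ 3 → a ≡ 3 ⊎ a ≡ 4
  Label-3 (vanish (s≤s (s≤s (s≤s ())))) refl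
  Label-3 (block {r} _ _) eq with *-cancelˡ-≡ (suc r) 1 3 eq
  Label-3 (block {zero} {zero} _ _) _ | refl = inj₁ refl
  Label-3 (block {zero} {1} _ _) _ | refl = inj₂ refl
  Label-3 (block {zero} {suc (suc _)} _ (s≤s (s≤s (s≤s (s≤s ()))))) _ | refl

  Label-≥4 : ∀ {t a} → Label t a → 4 ≤ t →
             a ≡ 0 ⊎ ∃[ r ] (t ≡ 3 * suc r × S r ≤ a × a ≤ 2 ^ suc (suc r))
  Label-≥4 generator (s≤s ())
  Label-≥4 square (s≤s (s≤s ()))
  Label-≥4 (vanish _) _ = inj₁ refl
  Label-≥4 (block {r} lo hi) _ = inj₂ (r , refl , lo , hi)

open Labels

module Coordinates {c ℓ : Level} (R : CommutativeRing c ℓ) where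
  open CommutativeRing R renaming (_+_ to _⊕_; _*_ to _⊗_)
  open WithRing R
  open import Relation.Binary.Reasoning.Setoid setoid

  ind-diag : ∀ a → ind a a ≈ 1#
  ind-diag a with a ≡ᵇ a in eq
  ... | true = refl
  ... | false = ⊥-elim (≡.subst T eq (ℕₚ.≡⇒≡ᵇ a a ≡.refl))

  ind-≢ : ∀ {a b} → a ≢ b → ind a b ≈ 0#
  ind-≢ {a} {b} a≢b with a ≡ᵇ b in eq
  ... | true = ⊥-elim (a≢b (ℕₚ.≡ᵇ⇒≡ a b (≡.subst T (≡.sym eq) _)))
  ... | false = refl

  ind-< : ∀ {a b} → a < b → ind a b ≈ 0#
  ind-< a<b = ind-≢ (ℕₚ.<⇒≢ a<b)

  ind-> : ∀ {a b} → b < a → ind a b ≈ 0#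
  ind-> b<a = ind-≢ (ℕₚ.>⇒≢ b<a)

  x≈0⇒x*y≈0 : ∀ {x y} → x ≈ 0# → x ⊗ y ≈ 0#
  x≈0⇒x*y≈0 x≈0 = trans (*-cong x≈0 refl) (zeroˡ _)

  y≈0⇒x*y≈0 : ∀ {x y} → y ≈ 0# → x ⊗ y ≈ 0#
  y≈0⇒x*y≈0 y≈0 = trans (*-cong refl y≈0) (zeroʳ _)

  +-vanishʳ : ∀ {x y u} → x ≈ u → y ≈ 0# → x ⊕ y ≈ u
  +-vanishʳ x≈u y≈0 = trans (+-cong x≈u y≈0) (+-identityʳ _)

  +-vanishˡ : ∀ {x y u} → x ≈ 0# → y ≈ u → x ⊕ y ≈ u
  +-vanishˡ x≈0 y≈u = trans (+-cong x≈0 y≈u) (+-identityˡ _)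

  monomial-1 : ∀ {u p q} → p ≈ 1# → q ≈ 1# → u ⊗ (p ⊗ q) ≈ u
  monomial-1 p≈1 q≈1 = trans (*-cong refl (trans (*-cong p≈1 q≈1) (*-identityˡ 1#))) (*-identityʳ _)

  monomial-0ˡ : ∀ {u p q} → p ≈ 0# → u ⊗ (p ⊗ q) ≈ 0#
  monomial-0ˡ p≈0 = y≈0⇒x*y≈0 (x≈0⇒x*y≈0 p≈0)

  monomial-0ʳ : ∀ {u p q} → q ≈ 0# → u ⊗ (p ⊗ q) ≈ 0#
  monomial-0ʳ q≈0 = y≈0⇒x*y≈0 (y≈0⇒x*y≈0 q≈0)

  sumTo-cong : ∀ N {f g : ℕ → Carrier} → (∀ j → j < N → f j ≈ g j) → sumTo N f ≈ sumTo N g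
  sumTo-cong zero _ = refl
  sumTo-cong (suc N) f≈g =
    +-cong (sumTo-cong N (λ j j<N → f≈g j (ℕₚ.m<n⇒m<1+n j<N))) (f≈g N (ℕₚ.n<1+n N))

  sumTo-zero : ∀ N {f : ℕ → Carrier} → (∀ j → j < N → f j ≈ 0#) → sumTo N f ≈ 0#
  sumTo-zero zero _ = refl
  sumTo-zero (suc N) f≈0 =
    +-vanishʳ (sumTo-zero N (λ j j<N → f≈0 j (ℕₚ.m<n⇒m<1+n j<N))) (f≈0 N (ℕₚ.n<1+n N))

  sumTo-single : ∀ N {f : ℕ → Carrier} i → i < N → (∀ j → j < N → j ≢ i → f j ≈ 0#) →
                 sumTo N f ≈ f i
  sumTo-single (suc N) i i<1+N f≈0 with ℕₚ.m≤n⇒m<n∨m≡n (ℕₚ.≤-pred i<1+N)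
  ... | inj₁ i<N = +-vanishʳ (sumTo-single N i i<N (λ j j<N → f≈0 j (ℕₚ.m<n⇒m<1+n j<N)))
                             (f≈0 N (ℕₚ.n<1+n N) (ℕₚ.>⇒≢ i<N))
  ... | inj₂ ≡.refl = +-vanishˡ (sumTo-zero N (λ j j<N → f≈0 j (ℕₚ.m<n⇒m<1+n j<N) (ℕₚ.<⇒≢ j<N))) refl

  sumTo-+ : ∀ a b (f : ℕ → Carrier) → sumTo (a + b) f ≈ sumTo a f ⊕ sumTo b (λ j → f (a + j))
  sumTo-+ a zero f rewrite ℕₚ.+-identityʳ a = sym (+-identityʳ _)
  sumTo-+ a (suc b) f rewrite ℕₚ.+-suc a b = begin
    sumTo (a + b) f ⊕ f (a + b)                          ≈⟨ +-cong (sumTo-+ a b f) refl ⟩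
    (sumTo a f ⊕ sumTo b (λ j → f (a + j))) ⊕ f (a + b)  ≈⟨ +-assoc _ _ _ ⟩
    sumTo a f ⊕ (sumTo b (λ j → f (a + j)) ⊕ f (a + b))  ∎

  sumFin-zero : ∀ {N} (f : Fin N → Carrier) → (∀ j → f j ≈ 0#) → sumFin f ≈ 0#
  sumFin-zero {zero} _ _ = refl
  sumFin-zero {suc N} f f≈0 = +-vanishʳ (f≈0 _) (sumFin-zero _ (λ j → f≈0 (Fin.suc j)))

  get-cong : ∀ {D} {x y : Vect D} → x ≋ y → ∀ l → get x l ≈ get y l
  get-cong _ zero = refl
  get-cong {D} x≋y (suc j) with j <? D
  ... | yes _ = x≋y _
  ... | no _ = refl

  get-+V : ∀ {D} (u w : Vect D) l → get (u +V w) l ≈ get u l ⊕ get w l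
  get-+V _ _ zero = sym (+-identityʳ 0#)
  get-+V {D} _ _ (suc j) with j <? D
  ... | yes _ = refl
  ... | no _ = sym (+-identityʳ 0#)

  get-e : ∀ {D} a {l} → 1 ≤ l → l ≤ D → get {D} (e a) l ≈ ind l a
  get-e {D} a {suc j} _ j<D with j <? D
  ... | yes p = reflexive (≡.cong (λ u → ind (suc u) a) (toℕ-fromℕ< p))
  ... | no ¬p = contradiction j<D ¬p

module NormalForm {c ℓ : Level} (R : CommutativeRing c ℓ) (m₁ n : ℕ)
                  (M : Fin (2 ^ suc m₁) → Fin n → Fin n → CommutativeRing.Carrier R) where
  open CommutativeRing R renaming (_+_ to _⊕_; _*_ to _⊗_)
  open WithRing R hiding (k)
  open Coordinates R
  open import Relation.Binary.Reasoning.Setoid setoid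

  m H k D L : ℕ
  m = suc m₁
  H = 2 ^ m
  k = kOf m
  D = k + n
  L = S m₁ ∸ 3

  2≤H : 2 ≤ H
  2≤H = ℕₚ.*-monoʳ-≤ 2 (ℕₚ.m^n>0 2 m₁)

  4≤k : 4 ≤ k
  4≤k = ℕₚ.*-monoʳ-≤ 2 2≤H

  H≤k : H ≤ k
  H≤k = ℕₚ.m≤m+n H (H + 0)

  k≤D : k ≤ D
  k≤D = ℕₚ.m≤m+n k n

  3+L≡1+H : 3 + L ≡ suc H
  3+L≡1+H = ≡.trans (ℕₚ.m+[n∸m]≡n (3≤S m₁)) (ℕₚ.+-comm H 1)

  j<L⇒3+j≤H : ∀ {j} → j < L → 3 + j ≤ H
  j<L⇒3+j≤H {j} j<L = ℕₚ.≤-pred (≡.subst (3 + j <_) 3+L≡1+H (ℕₚ.+-monoʳ-< 3 j<L))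

  3+j≤H⇒j<L : ∀ {j} → 3 + j ≤ H → j < L
  3+j≤H⇒j<L {j} h = ℕₚ.+-cancelˡ-< 3 j L (≡.subst (3 + j <_) (≡.sym 3+L≡1+H) (s≤s h))

  δ : ℕ → ℕ → Carrier
  δ a l = ind l a

  -- Coordinate c (1-based) of B(x, y) in terms of the coordinate functions X, Y of x, y, as long as y
  -- vanishes on (H, k].  The paper's B_{2j+S_i} = x_{j+S_{i−1}} y₃ and B_{2j+1+S_i} = x_{j+S_{i−1}} y₄
  -- become highTerm at l = j + S_{i−1}, since 2l − 1 = 2j + S_i; these l fill 3 ≤ l ≤ H.
  highTerm : (ℕ → Carrier) → (ℕ → Carrier) → ℕ → ℕ → Carrier
  highTerm X Y c l = ind c (2 * l ∸ 1) ⊗ (X l ⊗ Y 3) ⊕ ind c (2 * l) ⊗ (X l ⊗ Y 4)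

  lowPart highPart Bcoord : (ℕ → Carrier) → (ℕ → Carrier) → ℕ → Carrier
  lowPart X Y c = ind c 2 ⊗ (X 1 ⊗ Y 1) ⊕ (ind c 3 ⊗ (X 1 ⊗ Y 2) ⊕ ind c 4 ⊗ (X 2 ⊗ Y 1))
  highPart X Y c = sumTo L (λ j → highTerm X Y c (3 + j))
  Bcoord X Y c = lowPart X Y c ⊕ highPart X Y c

  highTerm-3+ : ∀ X Y c j → highTerm X Y c (3 + j) ≡
                ind c (5 + 2 * j) ⊗ (X (3 + j) ⊗ Y 3) ⊕ ind c (6 + 2 * j) ⊗ (X (3 + j) ⊗ Y 4)
  highTerm-3+ X Y c j = ≡.cong₂ (λ u w → ind c u ⊗ (X (3 + j) ⊗ Y 3) ⊕ ind c w ⊗ (X (3 + j) ⊗ Y 4))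
                          (≡.cong (_∸ 1) (2*[3+a]≡6+2*a j)) (2*[3+a]≡6+2*a j)

  highTerm-zeroˣ : ∀ X Y c l → X l ≈ 0# → highTerm X Y c l ≈ 0#
  highTerm-zeroˣ _ _ _ _ Xl≈0 = +-vanishʳ (monomial-0ˡ Xl≈0) (monomial-0ˡ Xl≈0)

  highPart-outside : ∀ X Y c → c < 5 ⊎ k < c → highPart X Y c ≈ 0#
  highPart-outside X Y c out = sumTo-zero L λ j j<L → begin
    highTerm X Y c (3 + j)  ≡⟨ highTerm-3+ X Y c j ⟩
    _                       ≈⟨ +-vanishʳ (x≈0⇒x*y≈0 (miss out (ℕₚ.m≤m+n 5 _) (5+2j≤k j<L)))
                                         (x≈0⇒x*y≈0 (miss out (ℕₚ.m≤m+n 5 (suc _)) (6+2j≤k j<L))) ⟩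
    0#                      ∎
    where
    6+2j≤k : ∀ {j} → j < L → 6 + 2 * j ≤ k
    6+2j≤k {j} j<L = ≡.subst (_≤ k) (2*[3+a]≡6+2*a j) (ℕₚ.*-monoʳ-≤ 2 (j<L⇒3+j≤H j<L))
    5+2j≤k : ∀ {j} → j < L → 5 + 2 * j ≤ k
    5+2j≤k j<L = ℕₚ.≤-trans (ℕₚ.n≤1+n _) (6+2j≤k j<L)
    miss : ∀ {t} → c < 5 ⊎ k < c → 5 ≤ t → t ≤ k → ind c t ≈ 0#
    miss (inj₁ c<5) 5≤t _ = ind-< (ℕₚ.<-≤-trans c<5 5≤t)
    miss (inj₂ k<c) _ t≤k = ind-> (ℕₚ.≤-<-trans t≤k k<c)

  highPart-small : ∀ {a} Y c → a < 3 → highPart (δ a) Y c ≈ 0#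
  highPart-small {a} Y c a<3 =
    sumTo-zero L (λ j _ → highTerm-zeroˣ (δ a) Y c (3 + j) (ind-> (ℕₚ.<-≤-trans a<3 (ℕₚ.m≤m+n 3 j))))

  highPart-single : ∀ {a} Y c → 3 + a ≤ H →
                    highPart (δ (3 + a)) Y c ≈ ind c (5 + 2 * a) ⊗ Y 3 ⊕ ind c (6 + 2 * a) ⊗ Y 4
  highPart-single {a} Y c 3+a≤H = begin
    highPart (δ (3 + a)) Y c
      ≈⟨ sumTo-single L a (3+j≤H⇒j<L 3+a≤H) (λ j _ j≢a → highTerm-zeroˣ (δ (3 + a)) Y c (3 + j)
                                                              (ind-≢ (j≢a ∘ ℕₚ.+-cancelˡ-≡ 3 j a))) ⟩
    highTerm (δ (3 + a)) Y c (3 + a)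
      ≡⟨ highTerm-3+ (δ (3 + a)) Y c a ⟩
    ind c (5 + 2 * a) ⊗ (ind (3 + a) (3 + a) ⊗ Y 3) ⊕ ind c (6 + 2 * a) ⊗ (ind (3 + a) (3 + a) ⊗ Y 4)
      ≈⟨ +-cong (*-cong refl (one (Y 3))) (*-cong refl (one (Y 4))) ⟩
    ind c (5 + 2 * a) ⊗ Y 3 ⊕ ind c (6 + 2 * a) ⊗ Y 4 ∎
    where
    one : ∀ y → ind (3 + a) (3 + a) ⊗ y ≈ y
    one y = trans (*-cong (ind-diag (3 + a)) refl) (*-identityˡ y)

  lowPart-zeroᶜ : ∀ X Y c → ind c 2 ≈ 0# → ind c 3 ≈ 0# → ind c 4 ≈ 0# → lowPart X Y c ≈ 0#
  lowPart-zeroᶜ _ _ _ i₂ i₃ i₄ = +-vanishʳ (x≈0⇒x*y≈0 i₂) (+-vanishʳ (x≈0⇒x*y≈0 i₃) (x≈0⇒x*y≈0 i₄))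

  lowPart-zeroˣ : ∀ X Y c → X 1 ≈ 0# → X 2 ≈ 0# → lowPart X Y c ≈ 0#
  lowPart-zeroˣ _ _ _ X₁≈0 X₂≈0 = +-vanishʳ (monomial-0ˡ X₁≈0) (+-vanishʳ (monomial-0ˡ X₁≈0) (monomial-0ˡ X₂≈0))

  Bcoord-beyond : ∀ X Y {c} → k < c → Bcoord X Y c ≈ 0#
  Bcoord-beyond X Y {c} k<c =
    +-vanishʳ (lowPart-zeroᶜ X Y c (beyond (s≤s (s≤s z≤n))) (beyond (s≤s (s≤s (s≤s z≤n)))) (beyond ℕₚ.≤-refl))
              (highPart-outside X Y c (inj₂ k<c))
    where
    beyond : ∀ {t} → t ≤ 4 → ind c t ≈ 0#
    beyond t≤4 = ind-> (ℕₚ.≤-<-trans (ℕₚ.≤-trans t≤4 4≤k) k<c)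

  sumTo-blocks : ∀ m′ (f : ℕ → Carrier) →
                 sumTo m′ (λ i → sumTo (2 ^ suc i) (λ j → f (j + S i))) ≈ sumTo (S m′ ∸ 3) (λ j → f (3 + j))
  sumTo-blocks zero f = refl
  sumTo-blocks (suc m′) f = begin
    sumTo m′ (λ i → sumTo (2 ^ suc i) (λ j → f (j + S i))) ⊕ sumTo X (λ j → f (j + S m′))
      ≈⟨ +-cong (sumTo-blocks m′ f) (sumTo-cong X (λ j _ → reflexive (≡.cong f (shift j)))) ⟩
    sumTo N (λ j → f (3 + j)) ⊕ sumTo X (λ j → f (3 + (N + j)))
      ≈⟨ sym (sumTo-+ N X (λ j → f (3 + j))) ⟩
    sumTo (N + X) (λ j → f (3 + j))
      ≡⟨ ≡.cong (λ u → sumTo (u ∸ 3) (λ j → f (3 + j))) size ⟩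
    sumTo (S (suc m′) ∸ 3) (λ j → f (3 + j)) ∎
    where
    X = 2 ^ suc m′
    N = S m′ ∸ 3
    3+N≡S : 3 + N ≡ S m′
    3+N≡S = ℕₚ.m+[n∸m]≡n (3≤S m′)
    shift : ∀ j → j + S m′ ≡ 3 + (N + j)
    shift j = ≡.trans (≡.cong (j +_) (≡.sym 3+N≡S)) (≡.trans (ℕₚ.+-comm j (3 + N)) (ℕₚ.+-assoc 3 N j))
    doubling : ∀ x → x + 1 + x ≡ 2 * x + 1
    doubling = solve-∀
    size : 3 + (N + X) ≡ S (suc m′)
    size = ≡.trans (≡.sym (ℕₚ.+-assoc 3 N X)) (≡.trans (≡.cong (_+ X) 3+N≡S) (doubling X))

  Bk≈Bcoord : ∀ x y c → Bk m n M x y (suc c) ≈ Bcoord (get x) (get y) (suc c)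
  Bk≈Bcoord x y 0 = sym (+-vanishʳ (lowPart-zeroᶜ (get x) (get y) 1 refl refl refl)
                                   (highPart-outside (get x) (get y) 1 (inj₁ (s≤s (s≤s z≤n)))))
  Bk≈Bcoord x y 1 = sym (+-vanishʳ (+-vanishʳ (*-identityˡ _) (+-vanishʳ (zeroˡ _) (zeroˡ _)))
                                   (highPart-outside (get x) (get y) 2 (inj₁ (s≤s (s≤s (s≤s z≤n))))))
  Bk≈Bcoord x y 2 = sym (+-vanishʳ (+-vanishˡ (zeroˡ _) (+-vanishʳ (*-identityˡ _) (zeroˡ _)))
                                   (highPart-outside (get x) (get y) 3 (inj₁ (s≤s (s≤s (s≤s (s≤s z≤n)))))))
  Bk≈Bcoord x y 3 = sym (+-vanishʳ (+-vanishˡ (zeroˡ _) (+-vanishˡ (zeroˡ _) (*-identityˡ _)))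
                                   (highPart-outside (get x) (get y) 4 (inj₁ ℕₚ.≤-refl)))
  Bk≈Bcoord x y (suc (suc (suc (suc w)))) = begin
    Bk m n M x y c₀
      ≈⟨ sumTo-cong m₁ (λ i _ → sumTo-cong (2 ^ suc i) (λ j _ → reflexive (regroup i j))) ⟩
    sumTo m₁ (λ i → sumTo (2 ^ suc i) (λ j → highTerm (get x) (get y) c₀ (j + S i)))
      ≈⟨ sumTo-blocks m₁ (highTerm (get x) (get y) c₀) ⟩
    highPart (get x) (get y) c₀
      ≈⟨ sym (+-vanishˡ (lowPart-zeroᶜ (get x) (get y) c₀ refl refl refl) refl) ⟩
    Bcoord (get x) (get y) c₀ ∎
    where
    c₀ = 5 + w
    odd : ∀ j X → 2 * (j + (X + 1)) ≡ suc (2 * j + (2 * X + 1))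
    odd = solve-∀
    even : ∀ j X → 2 * j + 1 + (2 * X + 1) ≡ 2 * (j + (X + 1))
    even = solve-∀
    regroup : ∀ i j → ind c₀ (2 * j + S (suc i)) ⊗ (get x (j + S i) ⊗ get y 3)
                      ⊕ ind c₀ (2 * j + 1 + S (suc i)) ⊗ (get x (j + S i) ⊗ get y 4)
                      ≡ highTerm (get x) (get y) c₀ (j + S i)
    regroup i j =
      ≡.cong₂ (λ u w → ind c₀ u ⊗ (get x (j + S i) ⊗ get y 3) ⊕ ind c₀ w ⊗ (get x (j + S i) ⊗ get y 4))
              (≡.sym (≡.cong (_∸ 1) (odd j (2 ^ suc i)))) (even j (2 ^ suc i))

  B≈Bcoord : ∀ {x y} → (∀ l → H < l → l ≤ k → get y l ≈ 0#) →
             ∀ c → B m n M x y c ≈ Bcoord (get x) (get y) (suc (toℕ c))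
  B≈Bcoord {x} {y} y-vanishes c with splitAt k c in eq
  ... | inj₁ c′ = begin
    Bk m n M x y (suc (toℕ c′))          ≈⟨ Bk≈Bcoord x y (toℕ c′) ⟩
    Bcoord (get x) (get y) (suc (toℕ c′)) ≡⟨ ≡.cong (λ u → Bcoord (get x) (get y) (suc u)) toℕc′≡toℕc ⟩
    Bcoord (get x) (get y) (suc (toℕ c))  ∎
    where
    toℕc′≡toℕc : toℕ c′ ≡ toℕ c
    toℕc′≡toℕc = ≡.trans (≡.sym (toℕ-↑ˡ c′ n)) (≡.cong toℕ (splitAt⁻¹-↑ˡ eq))
  ... | inj₂ j = trans (sumFin-zero _ (λ i → x≈0⇒x*y≈0 (y-vanishes _ (H<i+S i) (i+S≤k i))))
                       (sym (Bcoord-beyond (get x) (get y) k<1+c))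
    where
    H<i+S : ∀ i → H < toℕ i + S m₁
    H<i+S i = ℕₚ.≤-trans (≡.subst (H <_) (ℕₚ.+-comm 1 H) (ℕₚ.n<1+n H)) (ℕₚ.m≤n+m (S m₁) (toℕ i))
    shuffle : ∀ a X → a + (X + 1) ≡ suc a + X
    shuffle = solve-∀
    double : ∀ X → X + X ≡ 2 * X
    double = solve-∀
    i+S≤k : (i : Fin H) → toℕ i + S m₁ ≤ k
    i+S≤k i = ℕₚ.≤-trans (ℕₚ.≤-reflexive (shuffle (toℕ i) H))
                         (ℕₚ.≤-trans (ℕₚ.+-monoˡ-≤ H (toℕ<n i)) (ℕₚ.≤-reflexive (double H)))
    k<1+c : k < suc (toℕ c)
    k<1+c = s≤s (ℕₚ.≤-trans (ℕₚ.m≤m+n k (toℕ j))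
                            (ℕₚ.≤-reflexive (≡.trans (≡.sym (toℕ-↑ʳ k j)) (≡.cong toℕ (splitAt⁻¹-↑ʳ eq)))))

  Bcoord-cong : ∀ {X X′ Y Y′} → (∀ {l} → 1 ≤ l → l ≤ H → X l ≈ X′ l) → (∀ {l} → 1 ≤ l → l ≤ 4 → Y l ≈ Y′ l) →
                ∀ c → Bcoord X Y c ≈ Bcoord X′ Y′ c
  Bcoord-cong X≈ Y≈ c =
    +-cong (+-cong (*-cong refl (*-cong X₁ Y₁)) (+-cong (*-cong refl (*-cong X₁ Y₂)) (*-cong refl (*-cong X₂ Y₁))))
           (sumTo-cong L λ j j<L → let Xₗ = X≈ (s≤s z≤n) (j<L⇒3+j≤H j<L) in
              +-cong (*-cong refl (*-cong Xₗ Y₃)) (*-cong refl (*-cong Xₗ Y₄)))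
    where
    X₁ = X≈ ℕₚ.≤-refl (ℕₚ.≤-trans (s≤s z≤n) 2≤H)
    X₂ = X≈ (s≤s z≤n) 2≤H
    Y₁ = Y≈ ℕₚ.≤-refl (s≤s z≤n)
    Y₂ = Y≈ (s≤s z≤n) (s≤s (s≤s z≤n))
    Y₃ = Y≈ (s≤s z≤n) (s≤s (s≤s (s≤s z≤n)))
    Y₄ = Y≈ (s≤s z≤n) ℕₚ.≤-refl

  Bcoord-low : ∀ {a} b c {u} → a < 3 → lowPart (δ a) (δ b) c ≈ u → Bcoord (δ a) (δ b) c ≈ u
  Bcoord-low b c a<3 low = +-vanishʳ low (highPart-small (δ b) c a<3)

  Bcoord-basis : ∀ a b → a ≤ H → ∀ c → Bcoord (δ a) (δ b) (suc c) ≈ ind (suc c) (a ⋆ b)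
  Bcoord-basis 0 b _ c = Bcoord-low b (suc c) (s≤s z≤n) (lowPart-zeroˣ (δ 0) (δ b) (suc c) refl refl)
  Bcoord-basis 1 0 _ c = Bcoord-low 0 (suc c) (s≤s (s≤s z≤n))
    (+-vanishʳ (monomial-0ʳ refl) (+-vanishʳ (monomial-0ʳ refl) (monomial-0ˡ refl)))
  Bcoord-basis 1 1 _ c = Bcoord-low 1 (suc c) (s≤s (s≤s z≤n))
    (+-vanishʳ (monomial-1 refl refl) (+-vanishʳ (monomial-0ʳ refl) (monomial-0ˡ refl)))
  Bcoord-basis 1 2 _ c = Bcoord-low 2 (suc c) (s≤s (s≤s z≤n))
    (+-vanishˡ (monomial-0ʳ refl) (+-vanishʳ (monomial-1 refl refl) (monomial-0ˡ refl)))
  Bcoord-basis 1 (suc (suc (suc b))) _ c = Bcoord-low (3 + b) (suc c) (s≤s (s≤s z≤n))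
    (+-vanishʳ (monomial-0ʳ refl) (+-vanishʳ (monomial-0ʳ refl) (monomial-0ˡ refl)))
  Bcoord-basis 2 0 _ c = Bcoord-low 0 (suc c) ℕₚ.≤-refl
    (+-vanishʳ (monomial-0ˡ refl) (+-vanishʳ (monomial-0ˡ refl) (monomial-0ʳ refl)))
  Bcoord-basis 2 1 _ c = Bcoord-low 1 (suc c) ℕₚ.≤-refl
    (+-vanishˡ (monomial-0ˡ refl) (+-vanishˡ (monomial-0ˡ refl) (monomial-1 refl refl)))
  Bcoord-basis 2 (suc (suc b)) _ c = Bcoord-low (2 + b) (suc c) ℕₚ.≤-refl
    (+-vanishʳ (monomial-0ˡ refl) (+-vanishʳ (monomial-0ˡ refl) (monomial-0ʳ refl)))
  Bcoord-basis (suc (suc (suc a))) b 3+a≤H c =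
    +-vanishˡ (lowPart-zeroˣ (δ (3 + a)) (δ b) (suc c) refl refl)
              (trans (highPart-single (δ b) (suc c) 3+a≤H) (select b))
    where
    select : ∀ b → ind (suc c) (5 + 2 * a) ⊗ δ b 3 ⊕ ind (suc c) (6 + 2 * a) ⊗ δ b 4
                   ≈ ind (suc c) ((3 + a) ⋆ b)
    select 0 = +-vanishʳ (zeroʳ _) (zeroʳ _)
    select 1 = +-vanishʳ (zeroʳ _) (zeroʳ _)
    select 2 = +-vanishʳ (zeroʳ _) (zeroʳ _)
    select 3 = +-vanishʳ (*-identityʳ _) (zeroʳ _)
    select 4 = +-vanishˡ (zeroʳ _) (*-identityʳ _)
    select (suc (suc (suc (suc (suc _))))) = +-vanishʳ (zeroʳ _) (zeroʳ _)

  -- B reads π(x) only through the coordinates H < l ≤ k of y, so when these vanish B(x, y) depends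
  -- on the first k coordinates of x and y alone; there v = e₁ + e_{k+i} agrees with e₁.
  infix 4 _≈ₖ_
  _≈ₖ_ : Vect D → Vect D → Set ℓ
  x ≈ₖ w = ∀ {l} → 1 ≤ l → l ≤ k → get x l ≈ get w l

  ≋⇒≈ₖ : ∀ {x w} → x ≋ w → x ≈ₖ w
  ≋⇒≈ₖ x≋w {l} _ _ = get-cong x≋w l

  ≈ₖe⇒δ : ∀ {x a} → x ≈ₖ e a → ∀ {l} → 1 ≤ l → l ≤ k → get x l ≈ δ a l
  ≈ₖe⇒δ {a = a} x≈ 1≤l l≤k = trans (x≈ 1≤l l≤k) (get-e a 1≤l (ℕₚ.≤-trans l≤k k≤D))

  B-basis : ∀ {x y a b} → x ≈ₖ e a → y ≈ₖ e b → a ≤ H → b ≤ H → B m n M x y ≋ e (a ⋆ b)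
  B-basis {x} {y} {a} {b} x≈ y≈ a≤H b≤H c = begin
    B m n M x y c                        ≈⟨ B≈Bcoord y-vanishes c ⟩
    Bcoord (get x) (get y) (suc (toℕ c)) ≈⟨ Bcoord-cong {X′ = δ a} {Y′ = δ b} x≈δ y≈δ (suc (toℕ c)) ⟩
    Bcoord (δ a) (δ b) (suc (toℕ c))     ≈⟨ Bcoord-basis a b a≤H (toℕ c) ⟩
    e (a ⋆ b) c                          ∎
    where
    x≈δ : ∀ {l} → 1 ≤ l → l ≤ H → get x l ≈ δ a l
    x≈δ 1≤l l≤H = ≈ₖe⇒δ x≈ 1≤l (ℕₚ.≤-trans l≤H H≤k)
    y≈δ : ∀ {l} → 1 ≤ l → l ≤ 4 → get y l ≈ δ b l
    y≈δ 1≤l l≤4 = ≈ₖe⇒δ y≈ 1≤l (ℕₚ.≤-trans l≤4 4≤k)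
    y-vanishes : ∀ l → H < l → l ≤ k → get y l ≈ 0#
    y-vanishes l H<l l≤k = trans (≈ₖe⇒δ y≈ (ℕₚ.≤-trans (s≤s z≤n) H<l) l≤k) (ind-> (ℕₚ.≤-<-trans b≤H H<l))

module Orbit {c ℓ : Level} (R : CommutativeRing c ℓ) (m₁ n : ℕ)
             (M : Fin (2 ^ suc m₁) → Fin n → Fin n → CommutativeRing.Carrier R) (i : Fin n) where
  open CommutativeRing R renaming (_+_ to _⊕_; _*_ to _⊗_)
  open WithRing R hiding (k)
  open Coordinates R
  open NormalForm R m₁ n M

  v : Vect D
  v = e 1 +V e (k + suc (toℕ i))

  Aᵥ : ℕ → Vect D → Set (c ⊔ ℓ)
  Aᵥ = A m n M v

  ≈ₖ-refl : ∀ {x} → x ≈ₖ x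
  ≈ₖ-refl _ _ = refl

  v≈ₖe₁ : v ≈ₖ e 1
  v≈ₖe₁ {l} 1≤l l≤k = trans (get-+V (e 1) (e K) l) (+-vanishʳ refl (trans (get-e K 1≤l (ℕₚ.≤-trans l≤k k≤D)) l<K))
    where
    K = k + suc (toℕ i)
    l<K = ind-< (ℕₚ.≤-<-trans l≤k (ℕₚ.m<m+n k (s≤s z≤n)))

  v∈A₁ : Aᵥ 1 v
  v∈A₁ = base (λ _ → refl)

  A-resp : ∀ {t z w} → z ≋ w → Aᵥ t w → Aᵥ t z
  A-resp z≋w (base w≋v) = base (λ j → trans (z≋w j) (w≋v j))
  A-resp z≋w (step x y x∈A y∈A w≋B) = step x y x∈A y∈A (λ j → trans (z≋w j) (w≋B j))

  B-labelled : ∀ {p q a b x y} → Label (suc p) a → Label (suc q) b → suc p + suc q ≤ 3 * m →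
               x ≈ₖ e a → y ≈ₖ e b → B m n M x y ≋ e (a ⋆ b)
  B-labelled {p} {q} la lb bound x≈ y≈ =
    B-basis x≈ y≈ (Label-bound la (ℕₚ.<-≤-trans (ℕₚ.m<m+n (suc p) (s≤s z≤n)) bound))
                  (Label-bound lb (ℕₚ.<-≤-trans (ℕₚ.m<n+m (suc q) (s≤s z≤n)) bound))

  mutual
    A⇒≈ₖ : ∀ {t z} → Aᵥ t z → t ≤ 3 * m → ∃[ a ] (Label t a × z ≈ₖ e a)
    A⇒≈ₖ (base z≋v) _ = 1 , generator , λ 1≤l l≤k → trans (≋⇒≈ₖ z≋v 1≤l l≤k) (v≈ₖe₁ 1≤l l≤k)
    A⇒≈ₖ (step _ _ x∈A y∈A z≋B) bound with step⇒≋ x∈A y∈A bound z≋B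
    ... | a , la , z≋ea = a , la , ≋⇒≈ₖ z≋ea

    step⇒≋ : ∀ {p q x y z} → Aᵥ (suc p) x → Aᵥ (suc q) y → suc p + suc q ≤ 3 * m → z ≋ B m n M x y →
             ∃[ a ] (Label (suc p + suc q) a × z ≋ e a)
    step⇒≋ {p} {q} x∈A y∈A bound z≋B
      with A⇒≈ₖ x∈A (ℕₚ.≤-trans (ℕₚ.m≤m+n (suc p) (suc q)) bound)
         | A⇒≈ₖ y∈A (ℕₚ.≤-trans (ℕₚ.m≤n+m (suc q) (suc p)) bound)
    ... | a , la , x≈ | b , lb , y≈ =
      a ⋆ b , Label-⋆ la lb , λ j → trans (z≋B j) (B-labelled la lb bound x≈ y≈ j)

  A⇒≋ : ∀ {t z} → Aᵥ t z → 2 ≤ t → t ≤ 3 * m → ∃[ a ] (Label t a × z ≋ e a)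
  A⇒≋ (base _) (s≤s ()) _
  A⇒≋ (step _ _ x∈A y∈A z≋B) _ bound = step⇒≋ x∈A y∈A bound z≋B

  A-⋆ : ∀ {p q a b x y} → Label (suc p) a → Label (suc q) b → suc p + suc q ≤ 3 * m →
        Aᵥ (suc p) x → Aᵥ (suc q) y → x ≈ₖ e a → y ≈ₖ e b → Aᵥ (suc p + suc q) (e (a ⋆ b))
  A-⋆ la lb bound x∈A y∈A x≈ y≈ = step _ _ x∈A y∈A (λ j → sym (B-labelled la lb bound x≈ y≈ j))

  3≤3m : 3 ≤ 3 * m
  3≤3m = 3≤3*[1+r] m₁

  e₂∈A₂ : Aᵥ 2 (e 2)
  e₂∈A₂ = A-⋆ generator generator (ℕₚ.≤-trans (ℕₚ.n≤1+n 2) 3≤3m) v∈A₁ v∈A₁ v≈ₖe₁ v≈ₖe₁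

  e₃∈A₃ : Aᵥ 3 (e 3)
  e₃∈A₃ = A-⋆ generator square 3≤3m v∈A₁ e₂∈A₂ v≈ₖe₁ ≈ₖ-refl

  e₄∈A₃ : Aᵥ 3 (e 4)
  e₄∈A₃ = A-⋆ square generator 3≤3m e₂∈A₂ v∈A₁ ≈ₖ-refl v≈ₖe₁

  e₀∈A : ∀ d → 4 + d ≤ 3 * m → Aᵥ (4 + d) (e 0)
  e₀∈A zero bound = A-⋆ square square bound e₂∈A₂ e₂∈A₂ ≈ₖ-refl ≈ₖ-refl
  e₀∈A (suc d) bound = ≡.subst (λ t → Aᵥ t (e 0)) (ℕₚ.+-comm (4 + d) 1)
    (A-⋆ (vanish (ℕₚ.m≤m+n 4 d)) generator bound′ (e₀∈A d (ℕₚ.≤-trans (ℕₚ.n≤1+n _) bound)) v∈A₁ ≈ₖ-refl v≈ₖe₁)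
    where bound′ = ℕₚ.≤-trans (ℕₚ.≤-reflexive (ℕₚ.+-comm (4 + d) 1)) bound

  e-block∈A : ∀ r {j} → S r ≤ 3 + j → 3 + j ≤ 2 ^ suc (suc r) → 3 * suc r ≤ 3 * m →
              Aᵥ (3 * suc r) (e (3 + j))
  e-block∈A zero {0} _ _ _ = e₃∈A₃
  e-block∈A zero {1} _ _ _ = e₄∈A₃
  e-block∈A zero {suc (suc _)} _ (s≤s (s≤s (s≤s (s≤s ())))) _
  e-block∈A (suc r) {j} lo hi bound with block-halve {r} lo hi
  ... | a , lo′ , hi′ , halves = [ double label₃ e₃∈A₃ , double label₄ e₄∈A₃ ]′ halves
    where
    bound′ : 3 * suc r + 3 ≤ 3 * m
    bound′ = ℕₚ.≤-trans (ℕₚ.≤-reflexive (3*[1+r]+3≡3*[2+r] r)) bound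
    double : ∀ {b} → Label 3 b → Aᵥ 3 (e b) → 3 + j ≡ (3 + a) ⋆ b → Aᵥ (3 * suc (suc r)) (e (3 + j))
    double lb b∈A eq = ≡.subst₂ Aᵥ (3*[1+r]+3≡3*[2+r] r) (≡.cong e (≡.sym eq))
      (A-⋆ (block lo′ hi′) lb bound′ (e-block∈A r lo′ hi′ (ℕₚ.≤-trans (ℕₚ.m≤m+n _ 3) bound′)) b∈A
           ≈ₖ-refl ≈ₖ-refl)

  Label⇒∈A : ∀ {t a} → Label t a → 2 ≤ t → t ≤ 3 * m → Aᵥ t (e a)
  Label⇒∈A generator (s≤s ()) _
  Label⇒∈A square _ _ = e₂∈A₂
  Label⇒∈A (vanish {t} 4≤t) _ bound =
    ≡.subst (λ t → Aᵥ t (e 0)) 4+[t∸4]≡t (e₀∈A (t ∸ 4) (≡.subst (_≤ 3 * m) (≡.sym 4+[t∸4]≡t) bound))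
    where 4+[t∸4]≡t = ℕₚ.m+[n∸m]≡n 4≤t
  Label⇒∈A (block lo hi) _ bound = e-block∈A _ lo hi bound

  A₂ : ∀ z → Aᵥ 2 z ⇔ z ≋ e 2
  A₂ z = mk⇔ to (λ z≋e₂ → A-resp z≋e₂ e₂∈A₂)
    where
    to : Aᵥ 2 z → z ≋ e 2
    to z∈A with A⇒≋ z∈A ℕₚ.≤-refl (ℕₚ.≤-trans (ℕₚ.n≤1+n 2) 3≤3m)
    ... | _ , la , z≋ea = ≡.subst (λ a → z ≋ e a) (Label-2 la ≡.refl) z≋ea

  A₃ : ∀ z → Aᵥ 3 z ⇔ (z ≋ e 3 ⊎ z ≋ e 4)
  A₃ z = mk⇔ to [ (λ z≋e₃ → A-resp z≋e₃ e₃∈A₃) , (λ z≋e₄ → A-resp z≋e₄ e₄∈A₃) ]′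
    where
    to : Aᵥ 3 z → z ≋ e 3 ⊎ z ≋ e 4
    to z∈A with A⇒≋ z∈A (ℕₚ.n≤1+n 2) 3≤3m
    ... | _ , la , z≋ea with Label-3 la ≡.refl
    ...   | inj₁ ≡.refl = inj₁ z≋ea
    ...   | inj₂ ≡.refl = inj₂ z≋ea

  A-large : ∀ {t z} → 4 ≤ t → t ≤ 3 * m → Aᵥ t z →
            z ≋ zeroV ⊎ ∃[ r ] (t ≡ 3 * suc r × ∃[ j ] (S r ≤ j × j ≤ 2 ^ suc (suc r) × z ≋ e j))
  A-large 4≤t bound z∈A with A⇒≋ z∈A (ℕₚ.≤-trans (ℕₚ.m≤n+m 2 2) 4≤t) bound
  ... | _ , la , z≋ea with Label-≥4 la 4≤t
  ...   | inj₁ ≡.refl = inj₁ z≋ea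
  ...   | inj₂ (r , t≡ , lo , hi) = inj₂ (r , t≡ , _ , lo , hi , z≋ea)

  zeroV∈A : ∀ {t} → 4 ≤ t → t ≤ 3 * m → Aᵥ t zeroV
  zeroV∈A 4≤t = Label⇒∈A (vanish 4≤t) (ℕₚ.≤-trans (ℕₚ.m≤n+m 2 2) 4≤t)

  A-nonmultiple : ∀ {t} → 4 ≤ t → t ≤ 3 * m → ¬ (3 ∣ t) → ∀ z → Aᵥ t z ⇔ z ≋ zeroV
  A-nonmultiple 4≤t bound 3∤t z = mk⇔ to (λ z≋0 → A-resp z≋0 (zeroV∈A 4≤t bound))
    where
    to : Aᵥ _ z → z ≋ zeroV
    to z∈A with A-large 4≤t bound z∈A
    ... | inj₁ z≋0 = z≋0
    ... | inj₂ (r , t≡ , _) = ⊥-elim (3∤t (divides (suc r) (≡.trans t≡ (ℕₚ.*-comm 3 (suc r)))))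

  A-multiple : ∀ {t} → 4 ≤ t → t ≤ 3 * m → ∀ r → t ≡ 3 * r → ∀ z →
               Aᵥ t z ⇔ (z ≋ zeroV ⊎ ∃[ j ] (S (r ∸ 1) ≤ j × j ≤ S r ∸ 1 × z ≋ e j))
  A-multiple 4≤t _ zero ≡.refl _ = ⊥-elim (ℕₚ.<⇒≱ (s≤s z≤n) 4≤t)
  A-multiple {t} 4≤t bound (suc r) t≡3r z = mk⇔ to [ (λ z≋0 → A-resp z≋0 (zeroV∈A 4≤t bound)) , from ]′
    where
    S[1+r]∸1≡ : S (suc r) ∸ 1 ≡ 2 ^ suc (suc r)
    S[1+r]∸1≡ = ℕₚ.m+n∸n≡m _ 1
    to : Aᵥ t z → z ≋ zeroV ⊎ ∃[ j ] (S r ≤ j × j ≤ S (suc r) ∸ 1 × z ≋ e j)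
    to z∈A with A-large 4≤t bound z∈A
    ... | inj₁ z≋0 = inj₁ z≋0
    ... | inj₂ (r′ , t≡ , j , lo , hi , z≋ej) with ℕₚ.*-cancelˡ-≡ (suc r) (suc r′) 3 (≡.trans (≡.sym t≡3r) t≡)
    ...   | ≡.refl = inj₂ (j , lo , ≡.subst (j ≤_) (≡.sym S[1+r]∸1≡) hi , z≋ej)
    from : ∃[ j ] (S r ≤ j × j ≤ S (suc r) ∸ 1 × z ≋ e j) → Aᵥ t z
    from (j , lo , hi , z≋ej) = A-resp z≋ej (≡.subst (λ t → Aᵥ t (e j)) (≡.sym t≡3r)
      (Label⇒∈A (block′ lo (≡.subst (j ≤_) S[1+r]∸1≡ hi)) (ℕₚ.≤-trans (ℕₚ.n≤1+n 2) (3≤3*[1+r] r))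
                (≡.subst (_≤ 3 * m) t≡3r bound)))

mainTheorem4 : ∀ {c ℓ : Level} (R : CommutativeRing c ℓ) →
    let open WithRing R in
    (n m : ℕ) → 1 ≤ n → 2 ≤ m →
    (M : Fin (2 ^ m) → Fin n → Fin n → CommutativeRing.Carrier R) →
    (i : Fin n) →
    let v = e 1 +V e (kOf m + suc (toℕ i))
        At = A m n M v
    in ((∀ z → At 2 z ⇔ z ≋ e 2))
       × (∀ z → At 3 z ⇔ (z ≋ e 3 ⊎ z ≋ e 4))
       × (∀ t → 4 ≤ t → t ≤ 3 * m →
            (¬ (3 ∣ t) → ∀ z → At t z ⇔ z ≋ zeroV)
            × (∀ r → t ≡ 3 * r → ∀ z →
                 At t z ⇔ (z ≋ zeroV ⊎
                           ∃[ j ] (S (r ∸ 1) ≤ j × j ≤ S r ∸ 1 × z ≋ e j))))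
-- The argument needs only m ≥ 1; the hypothesis 2 ≤ m serves to exclude m = 0, and 1 ≤ n is
-- implied by i : Fin n.
mainTheorem4 R n (suc m₁) _ _ M i =
  A₂ , A₃ , λ _ 4≤t t≤3m → A-nonmultiple 4≤t t≤3m , A-multiple 4≤t t≤3m
  where open Orbit R m₁ n M i
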